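{- Let $n\ge5$ be an odd integer, let $s_1\in\mathbb{Z}_n$ with $1<s_1\le (n-1)/2$, and let $S\subseteq\mathbb{Z}_n\setminus\{0\}$ satisfy $-S=S$, $1,s_1\in S$, and either $S\cap\{2,3\}=\emptyset$ or $|S|\ge6$. Let $\Gamma=\mathrm{Circ}(n;S)$ and let $a\in\mathbb{Z}_n\setminus\{n-1,0,s_1-1,s_1\}$ be such that $\Gamma-\{0,s_1,a,a+1\}$ has no fractional perfect matching. Then $a>s_1$.
   Context: Elements of $\mathbb{Z}_n$ are identified with the integers $0,1,\dots,n-1$, and inequalities refer to these representatives. $\mathrm{Circ}(n;S)$ is the graph with vertex set $\mathbb{Z}_n$ in which $i$ is adjacent to $i+s$ for each $s\in S$. For a vertex set $U$, $\Gamma-U$ is the subgraph induced on the remaining vertices. A fractional perfect matching of a graph $(V,E)$ is a function $f:E\to[0,1]$ such that for every vertex $v$ the sum of $f(e)$ over edges incident to $v$ equals $1$. -}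

module Defs where

open import Data.Nat using (ℕ; zero; suc; _+_; _∸_; NonZero)
open import Data.Nat.DivMod using (_mod_)
open import Data.Fin using (Fin; toℕ)
open import Data.Fin.Subset using (Subset; _∈_; _∉_)
open import Data.Rational using (ℚ; 0ℚ; 1ℚ; _≤_) renaming (_+_ to _+ℚ_)
open import Data.Product using (_×_)
open import Relation.Nullary using (¬_)
open import Relation.Binary.PropositionalEquality using (_≡_)

ι : (n : ℕ) .{{_ : NonZero n}} → ℕ → Fin n
ι n k = k mod n

_⊕_ : {n : ℕ} .{{_ : NonZero n}} → Fin n → Fin n → Fin n
_⊕_ {n} i j = (toℕ i + toℕ j) mod n

_⊖_ : {n : ℕ} .{{_ : NonZero n}} → Fin n → Fin n → Fin n
_⊖_ {n} i j = (toℕ i + (n ∸ toℕ j)) mod n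

neg : {n : ℕ} .{{_ : NonZero n}} → Fin n → Fin n
neg {n} i = (n ∸ toℕ i) mod n

Adj : {n : ℕ} .{{_ : NonZero n}} → Subset n → Fin n → Fin n → Set
Adj S i j = (j ⊖ i) ∈ S

sumFin : (n : ℕ) → (Fin n → ℚ) → ℚ
sumFin zero    f = 0ℚ
sumFin (suc n) f = f Fin.zero +ℚ sumFin n (λ i → f (Fin.suc i))

-- A function on the edges is encoded as a symmetric
-- function on pairs of vertices that vanishes on non-edges of Circ(n;S) - U.
record FracPerfectMatching (n : ℕ) .{{_ : NonZero n}} (S : Subset n)
       (U : Fin n → Set) : Set where
  field
    f       : Fin n → Fin n → ℚ
    symm    : ∀ i j → f i j ≡ f j i
    nonneg  : ∀ i j → 0ℚ ≤ f i j
    le-one  : ∀ i j → f i j ≤ 1ℚ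
    support : ∀ i j → ¬ (Adj S i j × ¬ U i × ¬ U j) → f i j ≡ 0ℚ
    perfect : ∀ v → ¬ U v → sumFin n (f v) ≡ 1ℚ

{-# OPTIONS --safe #-}
module Submission where

-- Suppose a < s₁, so that 1 ≤ a ≤ s₁ − 2 and 2s₁ < n. A permutation σ of the vertices of
-- Γ − {0, s₁, a, a + 1} that moves every vertex to a neighbour, i.e. a cover by disjoint edges and
-- cycles, yields a fractional perfect matching: weight ½ on each pair {v, σ v}, hence 1 on 2-cycles.
-- With vertices labelled 0, …, n − 1 and k = s₁, such a cover uses the steps ±1 and ±k:
--   a + 2 < k:      the edges {v, v + k} for 1 ≤ v ≤ k − 2, v ∉ {a, a + 1}, the edge {a + k, a + k + 1}
--                   and the cycle (k − 1, 2k − 1, 2k, …, n − 1);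
--   a + 2 = k ≥ 4:  the edges {v, v + n − k} for 2 ≤ v ≤ k − 3, the edge {n − 2, n − 1}
--                   and the cycle (1, k + 1, k + 2, …, n − k + 1);
--   a = 1, k = 3:   the steps 1 and 3 are odd, so they only span a bipartite graph on the odd number
--                   of vertices 4, …, n − 1. Here |S| ≥ 6 provides an even t ∈ S with n − t ≥ 5, and
--                   the cycle (4, 5, …, 4 + t) together with the edges {5 + t, 6 + t}, …, {n − 2, n − 1}.

open import Defs
open import Algebra.Bundles using (CommutativeMonoid)
open import Data.Bool using (if_then_else_)
open import Data.Empty using (⊥-elim)
open import Data.Fin as Fin using (Fin; toℕ)
import Data.Fin.Properties as Finₚ
open import Data.Fin.Subset using (Subset; _∈_; _∉_; _∪_; ⁅_⁆; ∣_∣; _⊆_; inside; outside)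
open import Data.Fin.Subset.Properties using (p⊆q⇒∣p∣≤∣q∣; ∣⁅x⁆∣≡1; x∈p∪q⁺; x∈⁅x⁆; _∈?_)
open import Data.Nat using (ℕ; zero; suc; pred; _+_; _*_; _∸_; _≤_; _<_; _≤?_; _<?_; NonZero; z≤n; s≤s)
open import Data.Nat.Divisibility using (_∣_; _∣?_; divides; ∣m∣n⇒∣m+n)
open import Data.Nat.DivMod
  using (_%_; _/_; m≡m%n+[m/n]*n; m%n≤n; m%n%n≡m%n; m<n⇒m%n≡m; %-distribˡ-+; [m+n]%n≡m%n; [m+kn]%n≡m%n; m/n*n≤m)
open import Data.Nat.Properties
open import Data.Nat.Tactic.RingSolver using (solve-∀)
open import Data.Product using (_×_; _,_; proj₁; proj₂; ∃₂; ∃-syntax)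
open import Data.Rational using (ℚ; 0ℚ; 1ℚ; ½) renaming (_+_ to _+ℚ_; _≤_ to _≤ℚ_)
import Data.Rational.Properties as ℚ
open import Data.Sum using (_⊎_; inj₁; inj₂; [_,_])
open import Data.Vec.Base using ([]; _∷_)
open import Function.Base using (id; _∘_; _∘′_)
open import Function.Bundles using (_⇔_; mk⇔; Equivalence)
open import Relation.Binary.Definitions using (Symmetric)
open import Relation.Binary.PropositionalEquality
  using (_≡_; _≢_; refl; sym; trans; cong; cong₂; subst; subst₂; module ≡-Reasoning)
open import Relation.Nullary using (¬_; Dec; does; yes; no)
open import Relation.Nullary.Decidable using (dec-true; dec-false; from-yes; _×-dec_; _⊎-dec_; ¬?)
open import Relation.Unary using (Decidable)
open import Algebra.Properties.CommutativeSemigroup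
  (CommutativeMonoid.commutativeSemigroup ℚ.+-0-commutativeMonoid) using (interchange)

-- Cycle covers of subsets of ℕ

infix 4 _≤_<_
_≤_<_ : ℕ → ℕ → ℕ → Set
b ≤ v < e = (b ≤ v) × (v < e)

interval? : ∀ b e → Decidable (λ v → b ≤ v < e)
interval? b e v = (b ≤? v) ×-dec (v <? e)

record CycleCover (E : ℕ → ℕ → Set) (R : ℕ → Set) : Set where
  field
    σ τ      : ℕ → ℕ
    σ-closed : ∀ {v} → R v → R (σ v)
    τ-closed : ∀ {v} → R v → R (τ v)
    τ∘σ      : ∀ {v} → R v → τ (σ v) ≡ v
    σ∘τ      : ∀ {v} → R v → σ (τ v) ≡ v
    edge     : ∀ {v} → R v → E v (σ v)

module _ {E : ℕ → ℕ → Set} where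

  CycleCover-cong : ∀ {R R′ : ℕ → Set} → (∀ {v} → R v → R′ v) → (∀ {v} → R′ v → R v) →
                    CycleCover E R → CycleCover E R′
  CycleCover-cong to from C = record
    { σ = σ ; τ = τ
    ; σ-closed = to ∘′ σ-closed ∘′ from ; τ-closed = to ∘′ τ-closed ∘′ from
    ; τ∘σ = τ∘σ ∘′ from ; σ∘τ = σ∘τ ∘′ from ; edge = edge ∘′ from }
    where open CycleCover C

  module _ {R₁ R₂ : ℕ → Set} (R₁? : Decidable R₁) (disjoint : ∀ {v} → R₂ v → ¬ R₁ v) where

    private
      choose : (ℕ → ℕ) → (ℕ → ℕ) → ℕ → ℕ
      choose f g v = if does (R₁? v) then f v else g v

      choose₁ : ∀ {f g v} → R₁ v → choose f g v ≡ f v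
      choose₁ {v = v} r rewrite dec-true (R₁? v) r = refl

      choose₂ : ∀ {f g v} → R₂ v → choose f g v ≡ g v
      choose₂ {v = v} r rewrite dec-false (R₁? v) (disjoint r) = refl

    ⊎-cover : CycleCover E R₁ → CycleCover E R₂ → CycleCover E (λ v → R₁ v ⊎ R₂ v)
    ⊎-cover C₁ C₂ = record
      { σ = choose C₁.σ C₂.σ ; τ = choose C₁.τ C₂.τ
      ; σ-closed = σ-closed ; τ-closed = τ-closed ; τ∘σ = τ∘σ ; σ∘τ = σ∘τ ; edge = edge }
      where
      module C₁ = CycleCover C₁
      module C₂ = CycleCover C₂

      σ-closed : ∀ {v} → R₁ v ⊎ R₂ v → R₁ (choose C₁.σ C₂.σ v) ⊎ R₂ (choose C₁.σ C₂.σ v)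
      σ-closed (inj₁ r) rewrite choose₁ {C₁.σ} {C₂.σ} r = inj₁ (C₁.σ-closed r)
      σ-closed (inj₂ r) rewrite choose₂ {C₁.σ} {C₂.σ} r = inj₂ (C₂.σ-closed r)

      τ-closed : ∀ {v} → R₁ v ⊎ R₂ v → R₁ (choose C₁.τ C₂.τ v) ⊎ R₂ (choose C₁.τ C₂.τ v)
      τ-closed (inj₁ r) rewrite choose₁ {C₁.τ} {C₂.τ} r = inj₁ (C₁.τ-closed r)
      τ-closed (inj₂ r) rewrite choose₂ {C₁.τ} {C₂.τ} r = inj₂ (C₂.τ-closed r)

      τ∘σ : ∀ {v} → R₁ v ⊎ R₂ v → choose C₁.τ C₂.τ (choose C₁.σ C₂.σ v) ≡ v
      τ∘σ (inj₁ r) rewrite choose₁ {C₁.σ} {C₂.σ} r | choose₁ {C₁.τ} {C₂.τ} (C₁.σ-closed r) = C₁.τ∘σ r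
      τ∘σ (inj₂ r) rewrite choose₂ {C₁.σ} {C₂.σ} r | choose₂ {C₁.τ} {C₂.τ} (C₂.σ-closed r) = C₂.τ∘σ r

      σ∘τ : ∀ {v} → R₁ v ⊎ R₂ v → choose C₁.σ C₂.σ (choose C₁.τ C₂.τ v) ≡ v
      σ∘τ (inj₁ r) rewrite choose₁ {C₁.τ} {C₂.τ} r | choose₁ {C₁.σ} {C₂.σ} (C₁.τ-closed r) = C₁.σ∘τ r
      σ∘τ (inj₂ r) rewrite choose₂ {C₁.τ} {C₂.τ} r | choose₂ {C₁.σ} {C₂.σ} (C₂.τ-closed r) = C₂.σ∘τ r

      edge : ∀ {v} → R₁ v ⊎ R₂ v → E v (choose C₁.σ C₂.σ v)
      edge (inj₁ r) rewrite choose₁ {C₁.σ} {C₂.σ} r = C₁.edge r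
      edge (inj₂ r) rewrite choose₂ {C₁.σ} {C₂.σ} r = C₂.edge r

  involution-cover : ∀ {R : ℕ → Set} (ρ : ℕ → ℕ) → (∀ {v} → R v → R (ρ v)) →
                     (∀ {v} → R v → ρ (ρ v) ≡ v) → (∀ {v} → R v → E v (ρ v)) → CycleCover E R
  involution-cover ρ closed involutive edge = record
    { σ = ρ ; τ = ρ ; σ-closed = closed ; τ-closed = closed
    ; τ∘σ = involutive ; σ∘τ = involutive ; edge = edge }

-- The matching v ↔ v + d of the rows [b, e) and [b + d, e + d), except that h and h + 1 are
-- removed from the lower row and their partners h + d and h + 1 + d are matched with each other.
Ladder : (b e d h : ℕ) → ℕ → Set
Ladder b e d h v = (b ≤ v < e × v ≢ h × v ≢ suc h) ⊎ (b + d ≤ v < e + d)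

ladder? : ∀ b e d h → Decidable (Ladder b e d h)
ladder? b e d h v = (interval? b e v ×-dec ¬? (v ≟ h) ×-dec ¬? (v ≟ suc h)) ⊎-dec interval? (b + d) (e + d) v

module _ {b e d h : ℕ} where

  private
    data Rung : ℕ → Set where
      lower : ∀ {v} → b ≤ v < e → v ≢ h → v ≢ suc h → Rung v
      upper : ∀ {w} → b ≤ w < e → w ≢ h → w ≢ suc h → Rung (w + d)
      hole₀ : Rung (h + d)
      hole₁ : Rung (suc h + d)

    rung : ∀ {v} → Ladder b e d h v → Rung v
    rung (inj₁ (range , ≢h , ≢sh)) = lower range ≢h ≢sh
    rung {v} (inj₂ (b+d≤v , v<e+d)) = subst Rung (m∸n+n≡m d≤v) (shifted (v ∸ d) lo hi)
      where
      d≤v : d ≤ v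
      d≤v = m+n≤o⇒n≤o b b+d≤v
      lo : b ≤ v ∸ d
      lo = m+n≤o⇒m≤o∸n b b+d≤v
      hi : v ∸ d < e
      hi = subst (v ∸ d <_) (m+n∸n≡m e d) (∸-monoˡ-< v<e+d d≤v)
      shifted : ∀ w → b ≤ w → w < e → Rung (w + d)
      shifted w b≤w w<e with w ≟ h | w ≟ suc h
      ... | yes refl | _        = hole₀
      ... | no _     | yes refl = hole₁
      ... | no ≢h    | no ≢sh   = upper (b≤w , w<e) ≢h ≢sh

    ρ : ℕ → ℕ
    ρ v = if does (v <? b + d) then v + d
          else if does (v ≟ h + d) then suc h + d
          else if does (v ≟ suc h + d) then h + d
          else v ∸ d

    ρ-lower : ∀ {v} → v < b + d → ρ v ≡ v + d
    ρ-lower {v} v<b+d rewrite dec-true (v <? b + d) v<b+d = refl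

    not-lower : ∀ {w} → b ≤ w → ¬ (w + d < b + d)
    not-lower b≤w = ≤⇒≯ (+-monoˡ-≤ _ b≤w)

    ρ-upper : ∀ {w} → b ≤ w → w ≢ h → w ≢ suc h → ρ (w + d) ≡ w
    ρ-upper {w} b≤w ≢h ≢sh
      rewrite dec-false (w + d <? b + d) (not-lower b≤w)
            | dec-false (w + d ≟ h + d) (≢h ∘ +-cancelʳ-≡ d w h)
            | dec-false (w + d ≟ suc h + d) (≢sh ∘ +-cancelʳ-≡ d w (suc h)) = m+n∸n≡m w d

    ρ-hole₀ : b ≤ h → ρ (h + d) ≡ suc h + d
    ρ-hole₀ b≤h rewrite dec-false (h + d <? b + d) (not-lower b≤h) | dec-true (h + d ≟ h + d) refl = refl

    ρ-hole₁ : b ≤ h → ρ (suc h + d) ≡ h + d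
    ρ-hole₁ b≤h
      rewrite dec-false (suc h + d <? b + d) (not-lower (m≤n⇒m≤1+n b≤h))
            | dec-false (suc h + d ≟ h + d) (λ eq → <-irrefl (sym eq) (n<1+n (h + d)))
            | dec-true (suc h + d ≟ suc h + d) refl = refl

  ladder-cover : ∀ {E : ℕ → ℕ → Set} → Symmetric E → e ≤ b + d → b ≤ h → 2 + h ≤ e →
                 (∀ v → E v (v + d)) → E (h + d) (suc h + d) → CycleCover E (Ladder b e d h)
  ladder-cover {E} E-sym e≤b+d b≤h 2+h≤e step hole-edge = involution-cover ρ closed involutive edge
    where
    h<e : h < e
    h<e = <⇒≤ 2+h≤e
    shift-upper : ∀ {v} → b ≤ v < e → b + d ≤ v + d < e + d
    shift-upper (b≤v , v<e) = +-monoˡ-≤ d b≤v , +-monoˡ-< d v<e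

    closed : ∀ {v} → Ladder b e d h v → Ladder b e d h (ρ v)
    closed r with rung r
    ... | lower range ≢h ≢sh rewrite ρ-lower (<-≤-trans (proj₂ range) e≤b+d) = inj₂ (shift-upper range)
    ... | upper range ≢h ≢sh rewrite ρ-upper (proj₁ range) ≢h ≢sh = inj₁ (range , ≢h , ≢sh)
    ... | hole₀ rewrite ρ-hole₀ b≤h = inj₂ (shift-upper (m≤n⇒m≤1+n b≤h , 2+h≤e))
    ... | hole₁ rewrite ρ-hole₁ b≤h = inj₂ (shift-upper (b≤h , h<e))

    involutive : ∀ {v} → Ladder b e d h v → ρ (ρ v) ≡ v
    involutive r with rung r
    ... | lower range ≢h ≢sh rewrite ρ-lower (<-≤-trans (proj₂ range) e≤b+d) = ρ-upper (proj₁ range) ≢h ≢sh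
    ... | upper range ≢h ≢sh rewrite ρ-upper (proj₁ range) ≢h ≢sh = ρ-lower (<-≤-trans (proj₂ range) e≤b+d)
    ... | hole₀ rewrite ρ-hole₀ b≤h = ρ-hole₁ b≤h
    ... | hole₁ rewrite ρ-hole₁ b≤h = ρ-hole₀ b≤h

    edge : ∀ {v} → Ladder b e d h v → E v (ρ v)
    edge r with rung r
    ... | lower range _ _ rewrite ρ-lower (<-≤-trans (proj₂ range) e≤b+d) = step _
    ... | upper range ≢h ≢sh rewrite ρ-upper (proj₁ range) ≢h ≢sh = E-sym (step _)
    ... | hole₀ rewrite ρ-hole₀ b≤h = hole-edge
    ... | hole₁ rewrite ρ-hole₁ b≤h = E-sym hole-edge

-- The cycle c → b → b + 1 → ⋯ → e → c.
Cycle : (c b e : ℕ) → ℕ → Set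
Cycle c b e v = v ≡ c ⊎ (b ≤ v × v ≤ e)

module _ {c b e : ℕ} where

  private
    data Forward : ℕ → Set where
      apex  : Forward c
      inner : ∀ {v} → b ≤ v → v < e → Forward v
      last  : Forward e

    data Backward : ℕ → Set where
      apex  : Backward c
      first : Backward b
      inner : ∀ {w} → b ≤ w → w < e → Backward (suc w)

    forward : ∀ {v} → Cycle c b e v → Forward v
    forward (inj₁ refl) = apex
    forward (inj₂ (b≤v , v≤e)) with m≤n⇒m<n∨m≡n v≤e
    ... | inj₁ v<e  = inner b≤v v<e
    ... | inj₂ refl = last

    backward : ∀ {v} → Cycle c b e v → Backward v
    backward (inj₁ refl) = apex
    backward (inj₂ (b≤v , v≤e)) with m≤n⇒m<n∨m≡n b≤v
    ... | inj₂ refl = first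
    backward {suc w} (inj₂ (b≤v , v≤e)) | inj₁ b<v = inner (≤-pred b<v) v≤e

    σ τ : ℕ → ℕ
    σ v = if does (v ≟ c) then b else if does (v <? e) then suc v else c
    τ v = if does (v ≟ c) then e else if does (v ≟ b) then c else pred v

    σ-apex : σ c ≡ b
    σ-apex rewrite dec-true (c ≟ c) refl = refl

    σ-inner : ∀ {v} → v ≢ c → v < e → σ v ≡ suc v
    σ-inner {v} v≢c v<e rewrite dec-false (v ≟ c) v≢c | dec-true (v <? e) v<e = refl

    σ-last : e ≢ c → σ e ≡ c
    σ-last e≢c rewrite dec-false (e ≟ c) e≢c | dec-false (e <? e) (<-irrefl refl) = refl

    τ-apex : τ c ≡ e
    τ-apex rewrite dec-true (c ≟ c) refl = refl

    τ-first : b ≢ c → τ b ≡ c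
    τ-first b≢c rewrite dec-false (b ≟ c) b≢c | dec-true (b ≟ b) refl = refl

    τ-inner : ∀ {w} → suc w ≢ c → b ≤ w → τ (suc w) ≡ w
    τ-inner {w} sw≢c b≤w rewrite dec-false (suc w ≟ c) sw≢c | dec-false (suc w ≟ b) (>⇒≢ (s≤s b≤w)) = refl

  cycle-cover : ∀ {E : ℕ → ℕ → Set} → b ≤ e → c < b ⊎ e < c → E c b → E e c → (∀ v → E v (suc v)) →
                CycleCover E (Cycle c b e)
  cycle-cover {E} b≤e c∉[b,e] apex-edge last-edge step = record
    { σ = σ ; τ = τ ; σ-closed = σ-closed ; τ-closed = τ-closed ; τ∘σ = τ∘σ ; σ∘τ = σ∘τ ; edge = edge }
    where
    off-apex : ∀ {v} → b ≤ v → v ≤ e → v ≢ c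
    off-apex b≤v v≤e = [ (λ c<b → >⇒≢ (<-≤-trans c<b b≤v)) , (λ e<c → <⇒≢ (≤-<-trans v≤e e<c)) ] c∉[b,e]

    b≢c : b ≢ c
    b≢c = off-apex ≤-refl b≤e

    e≢c : e ≢ c
    e≢c = off-apex b≤e ≤-refl

    σ-closed : ∀ {v} → Cycle c b e v → Cycle c b e (σ v)
    σ-closed r with forward r
    ... | apex rewrite σ-apex = inj₂ (≤-refl , b≤e)
    ... | inner b≤v v<e rewrite σ-inner (off-apex b≤v (<⇒≤ v<e)) v<e = inj₂ (m≤n⇒m≤1+n b≤v , v<e)
    ... | last rewrite σ-last e≢c = inj₁ refl

    τ-closed : ∀ {v} → Cycle c b e v → Cycle c b e (τ v)
    τ-closed r with backward r
    ... | apex rewrite τ-apex = inj₂ (b≤e , ≤-refl)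
    ... | first rewrite τ-first b≢c = inj₁ refl
    ... | inner b≤w w<e rewrite τ-inner (off-apex (m≤n⇒m≤1+n b≤w) w<e) b≤w = inj₂ (b≤w , <⇒≤ w<e)

    τ∘σ : ∀ {v} → Cycle c b e v → τ (σ v) ≡ v
    τ∘σ r with forward r
    ... | apex rewrite σ-apex = τ-first b≢c
    ... | inner b≤v v<e rewrite σ-inner (off-apex b≤v (<⇒≤ v<e)) v<e = τ-inner (off-apex (m≤n⇒m≤1+n b≤v) v<e) b≤v
    ... | last rewrite σ-last e≢c = τ-apex

    σ∘τ : ∀ {v} → Cycle c b e v → σ (τ v) ≡ v
    σ∘τ r with backward r
    ... | apex rewrite τ-apex = σ-last e≢c
    ... | first rewrite τ-first b≢c = σ-apex
    ... | inner b≤w w<e rewrite τ-inner (off-apex (m≤n⇒m≤1+n b≤w) w<e) b≤w = σ-inner (off-apex b≤w (<⇒≤ w<e)) w<e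

    edge : ∀ {v} → Cycle c b e v → E v (σ v)
    edge r with forward r
    ... | apex rewrite σ-apex = apex-edge
    ... | inner b≤v v<e rewrite σ-inner (off-apex b≤v (<⇒≤ v<e)) v<e = step _
    ... | last rewrite σ-last e≢c = last-edge

module _ {E : ℕ → ℕ → Set} where

  empty-cover : ∀ {R : ℕ → Set} → (∀ {v} → ¬ R v) → CycleCover E R
  empty-cover empty = involution-cover id (⊥-elim ∘ empty) (⊥-elim ∘ empty) (⊥-elim ∘ empty)

  pair-cover : Symmetric E → ∀ {x y} → x ≢ y → E x y → CycleCover E (λ v → v ≡ x ⊎ v ≡ y)
  pair-cover E-sym {x} {y} x≢y x~y = involution-cover swap closed involutive edge
    where
    swap : ℕ → ℕ
    swap v = if does (v ≟ x) then y else x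

    swap-x : swap x ≡ y
    swap-x rewrite dec-true (x ≟ x) refl = refl

    swap-y : swap y ≡ x
    swap-y rewrite dec-false (y ≟ x) (x≢y ∘ sym) = refl

    closed : ∀ {v} → v ≡ x ⊎ v ≡ y → swap v ≡ x ⊎ swap v ≡ y
    closed (inj₁ refl) = inj₂ swap-x
    closed (inj₂ refl) = inj₁ swap-y

    involutive : ∀ {v} → v ≡ x ⊎ v ≡ y → swap (swap v) ≡ v
    involutive (inj₁ refl) = trans (cong swap swap-x) swap-y
    involutive (inj₂ refl) = trans (cong swap swap-y) swap-x

    edge : ∀ {v} → v ≡ x ⊎ v ≡ y → E v (swap v)
    edge (inj₁ refl) = subst (E x) (sym swap-x) x~y
    edge (inj₂ refl) = subst (E y) (sym swap-y) (E-sym x~y)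

  pairs-cover : Symmetric E → (∀ v → E v (suc v)) → ∀ b m → CycleCover E (λ v → b ≤ v < b + 2 * m)
  pairs-cover E-sym step b zero = empty-cover λ (b≤v , v<b+0) → <⇒≱ (subst (_ <_) (+-identityʳ b) v<b+0) b≤v
  pairs-cover E-sym step b (suc m) =
    CycleCover-cong join split
      (⊎-cover (λ v → (v ≟ b) ⊎-dec (v ≟ suc b)) disjoint
        (pair-cover E-sym (<⇒≢ (n<1+n b)) (step b)) (pairs-cover E-sym step (2 + b) m))
    where
    end : b + 2 * suc m ≡ 2 + b + 2 * m
    end = shift b m
      where
      shift : ∀ b m → b + 2 * suc m ≡ 2 + b + 2 * m
      shift = solve-∀

    split : ∀ {v} → b ≤ v < b + 2 * suc m → (v ≡ b ⊎ v ≡ suc b) ⊎ (2 + b ≤ v < 2 + b + 2 * m)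
    split {v} (b≤v , v<end) with m≤n⇒m<n∨m≡n b≤v
    ... | inj₂ refl = inj₁ (inj₁ refl)
    ... | inj₁ b<v with m≤n⇒m<n∨m≡n b<v
    ...   | inj₂ refl  = inj₁ (inj₂ refl)
    ...   | inj₁ 1+b<v = inj₂ (1+b<v , subst (v <_) end v<end)

    join : ∀ {v} → (v ≡ b ⊎ v ≡ suc b) ⊎ (2 + b ≤ v < 2 + b + 2 * m) → b ≤ v < b + 2 * suc m
    join (inj₁ (inj₁ refl)) = ≤-refl , subst (b <_) (sym end) (s≤s (≤-trans (n≤1+n b) (m≤m+n (suc b) (2 * m))))
    join (inj₁ (inj₂ refl)) = n≤1+n b , subst (suc b <_) (sym end) (m≤m+n (2 + b) (2 * m))
    join {v} (inj₂ (2+b≤v , v<end)) = ≤-trans (m≤n+m b 2) 2+b≤v , subst (v <_) (sym end) v<end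

    disjoint : ∀ {v} → 2 + b ≤ v < 2 + b + 2 * m → ¬ (v ≡ b ⊎ v ≡ suc b)
    disjoint (2+b≤b , _)   (inj₁ refl) = <⇒≱ (≤-refl {suc b}) (≤-trans (n≤1+n _) 2+b≤b)
    disjoint (2+b≤1+b , _) (inj₂ refl) = <-irrefl refl 2+b≤1+b

-- Finite sums, counting and parity

sumFin-cong : ∀ m {f g : Fin m → ℚ} → (∀ j → f j ≡ g j) → sumFin m f ≡ sumFin m g
sumFin-cong zero    f≡g = refl
sumFin-cong (suc m) f≡g = cong₂ _+ℚ_ (f≡g Fin.zero) (sumFin-cong m (f≡g ∘ Fin.suc))

sumFin-+ : ∀ m (f g : Fin m → ℚ) → sumFin m (λ j → f j +ℚ g j) ≡ sumFin m f +ℚ sumFin m g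
sumFin-+ zero    f g = refl
sumFin-+ (suc m) f g = trans (cong (f Fin.zero +ℚ g Fin.zero +ℚ_) (sumFin-+ m (f ∘ Fin.suc) (g ∘ Fin.suc)))
                             (interchange (f Fin.zero) (g Fin.zero) _ _)

sumFin-zero : ∀ m (g : ℕ → ℚ) → (∀ y → g y ≡ 0ℚ) → sumFin m (g ∘ toℕ) ≡ 0ℚ
sumFin-zero zero    g g≡0 = refl
sumFin-zero (suc m) g g≡0 = cong₂ _+ℚ_ (g≡0 0) (sumFin-zero m (g ∘ suc) (g≡0 ∘ suc))

sumFin-point : ∀ m (g : ℕ → ℚ) {p} → p < m → (∀ y → y ≢ p → g y ≡ 0ℚ) → sumFin m (g ∘ toℕ) ≡ g p
sumFin-point (suc m) g {zero} _ g≡0 =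
  trans (cong (g 0 +ℚ_) (sumFin-zero m (g ∘ suc) (λ y → g≡0 (suc y) λ ()))) (ℚ.+-identityʳ (g 0))
sumFin-point (suc m) g {suc p} (s≤s p<m) g≡0 =
  trans (cong₂ _+ℚ_ (g≡0 0 λ ()) (sumFin-point m (g ∘ suc) p<m (λ y y≢p → g≡0 (suc y) (y≢p ∘ suc-injective))))
        (ℚ.+-identityˡ (g (suc p)))

½⟦_⟧ : ∀ {P : Set} → Dec P → ℚ
½⟦ yes _ ⟧ = ½
½⟦ no _ ⟧  = 0ℚ

½⟦⟧-cong : ∀ {P Q : Set} → (P → Q) → (Q → P) → (p : Dec P) (q : Dec Q) → ½⟦ p ⟧ ≡ ½⟦ q ⟧
½⟦⟧-cong P→Q Q→P (yes _) (yes _) = refl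
½⟦⟧-cong P→Q Q→P (yes p) (no ¬q) = ⊥-elim (¬q (P→Q p))
½⟦⟧-cong P→Q Q→P (no ¬p) (yes q) = ⊥-elim (¬p (Q→P q))
½⟦⟧-cong P→Q Q→P (no _)  (no _)  = refl

½⟦⟧+½⟦⟧-bounds : ∀ {P Q : Set} (p : Dec P) (q : Dec Q) → 0ℚ ≤ℚ ½⟦ p ⟧ +ℚ ½⟦ q ⟧ × ½⟦ p ⟧ +ℚ ½⟦ q ⟧ ≤ℚ 1ℚ
½⟦⟧+½⟦⟧-bounds (yes _) (yes _) = from-yes (0ℚ ℚ.≤? ½ +ℚ ½)   , from-yes (½ +ℚ ½ ℚ.≤? 1ℚ)
½⟦⟧+½⟦⟧-bounds (yes _) (no _)  = from-yes (0ℚ ℚ.≤? ½ +ℚ 0ℚ)  , from-yes (½ +ℚ 0ℚ ℚ.≤? 1ℚ)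
½⟦⟧+½⟦⟧-bounds (no _)  (yes _) = from-yes (0ℚ ℚ.≤? 0ℚ +ℚ ½)  , from-yes (0ℚ +ℚ ½ ℚ.≤? 1ℚ)
½⟦⟧+½⟦⟧-bounds (no _)  (no _)  = from-yes (0ℚ ℚ.≤? 0ℚ +ℚ 0ℚ) , from-yes (0ℚ +ℚ 0ℚ ℚ.≤? 1ℚ)

0≤0≤1 : 0ℚ ≤ℚ 0ℚ × 0ℚ ≤ℚ 1ℚ
0≤0≤1 = ℚ.≤-refl , from-yes (0ℚ ℚ.≤? 1ℚ)

sumFin-½⟦≟⟧ : ∀ m {p} → p < m → sumFin m (λ j → ½⟦ toℕ j ≟ p ⟧) ≡ ½
sumFin-½⟦≟⟧ m {p} p<m = trans (sumFin-point m (λ y → ½⟦ y ≟ p ⟧) p<m off-p) on-p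
  where
  off-p : ∀ y → y ≢ p → ½⟦ y ≟ p ⟧ ≡ 0ℚ
  off-p y y≢p with y ≟ p
  ... | yes y≡p = ⊥-elim (y≢p y≡p)
  ... | no _    = refl
  on-p : ½⟦ p ≟ p ⟧ ≡ ½
  on-p with p ≟ p
  ... | yes _   = refl
  ... | no p≢p  = ⊥-elim (p≢p refl)

∣p∪q∣≤∣p∣+∣q∣ : ∀ {n} (p q : Subset n) → ∣ p ∪ q ∣ ≤ ∣ p ∣ + ∣ q ∣
∣p∪q∣≤∣p∣+∣q∣ []            []            = z≤n
∣p∪q∣≤∣p∣+∣q∣ (inside ∷ p)  (inside ∷ q)  =
  s≤s (≤-trans (∣p∪q∣≤∣p∣+∣q∣ p q) (≤-trans (n≤1+n _) (≤-reflexive (sym (+-suc ∣ p ∣ ∣ q ∣)))))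
∣p∪q∣≤∣p∣+∣q∣ (inside ∷ p)  (outside ∷ q) = s≤s (∣p∪q∣≤∣p∣+∣q∣ p q)
∣p∪q∣≤∣p∣+∣q∣ (outside ∷ p) (inside ∷ q)  = ≤-trans (s≤s (∣p∪q∣≤∣p∣+∣q∣ p q)) (≤-reflexive (sym (+-suc ∣ p ∣ ∣ q ∣)))
∣p∪q∣≤∣p∣+∣q∣ (outside ∷ p) (outside ∷ q) = ∣p∪q∣≤∣p∣+∣q∣ p q

∣q∣<∣p∣⇒∃∈p∉q : ∀ {n} {p q : Subset n} → ∣ q ∣ < ∣ p ∣ → ∃[ x ] x ∈ p × x ∉ q
∣q∣<∣p∣⇒∃∈p∉q {p = p} {q} ∣q∣<∣p∣ with Finₚ.any? (λ x → (x ∈? p) ×-dec ¬? (x ∈? q))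
... | yes witness = witness
... | no  none    = ⊥-elim (<⇒≱ ∣q∣<∣p∣ (p⊆q⇒∣p∣≤∣q∣ p⊆q))
  where
  p⊆q : p ⊆ q
  p⊆q {x} x∈p with x ∈? q
  ... | yes x∈q = x∈q
  ... | no  x∉q = ⊥-elim (none (x , x∈p , x∉q))

∣⁅x⁆∪p∣≤1+∣p∣ : ∀ {n} (x : Fin n) (p : Subset n) → ∣ ⁅ x ⁆ ∪ p ∣ ≤ suc ∣ p ∣
∣⁅x⁆∪p∣≤1+∣p∣ x p = ≤-trans (∣p∪q∣≤∣p∣+∣q∣ ⁅ x ⁆ p) (≤-reflexive (cong (_+ ∣ p ∣) (∣⁅x⁆∣≡1 x)))

∣⁅a,b,c,d⁆∣≤4 : ∀ {n} (a b c d : Fin n) → ∣ ⁅ a ⁆ ∪ (⁅ b ⁆ ∪ (⁅ c ⁆ ∪ ⁅ d ⁆)) ∣ ≤ 4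
∣⁅a,b,c,d⁆∣≤4 a b c d =
  ≤-trans (∣⁅x⁆∪p∣≤1+∣p∣ a _) (s≤s (≤-trans (∣⁅x⁆∪p∣≤1+∣p∣ b _) (s≤s (≤-trans (∣⁅x⁆∪p∣≤1+∣p∣ c _)
    (s≤s (≤-reflexive (∣⁅x⁆∣≡1 d)))))))

even-or-odd : ∀ o → ∃[ h ] (o ≡ 2 * h ⊎ o ≡ 1 + 2 * h)
even-or-odd zero = 0 , inj₁ refl
even-or-odd (suc zero) = 0 , inj₂ refl
even-or-odd (suc (suc o)) with even-or-odd o
... | h , inj₁ refl = suc h , inj₁ (sym (*-suc 2 h))
... | h , inj₂ refl = suc h , inj₂ (cong suc (sym (*-suc 2 h)))

odd≢1,3⇒≡5+2* : ∀ {o} → ¬ 2 ∣ o → o ≢ 1 → o ≢ 3 → ∃[ m ] o ≡ 5 + 2 * m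
odd≢1,3⇒≡5+2* {o} o-odd o≢1 o≢3 with even-or-odd o
... | h , inj₁ refl = ⊥-elim (o-odd (divides h (*-comm 2 h)))
... | zero , inj₂ refl = ⊥-elim (o≢1 refl)
... | suc zero , inj₂ refl = ⊥-elim (o≢3 refl)
... | suc (suc m) , inj₂ refl = m , shift m
  where
  shift : ∀ m → 1 + 2 * (2 + m) ≡ 5 + 2 * m
  shift = solve-∀

-- Arithmetic modulo n

module _ (n : ℕ) .{{_ : NonZero n}} where

  toℕ-ι : ∀ v → toℕ (ι n v) ≡ v % n
  toℕ-ι v = Finₚ.toℕ-fromℕ< _

  toℕ-ι< : ∀ {v} → v < n → toℕ (ι n v) ≡ v
  toℕ-ι< v<n = trans (toℕ-ι _) (m<n⇒m%n≡m v<n)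

  ι-toℕ : ∀ (x : Fin n) → ι n (toℕ x) ≡ x
  ι-toℕ x = Finₚ.toℕ-injective (toℕ-ι< (Finₚ.toℕ<n x))

  [m%n+k]%n≡[m+k]%n : ∀ m k → (m % n + k) % n ≡ (m + k) % n
  [m%n+k]%n≡[m+k]%n m k = begin
    (m % n + k) % n          ≡⟨ %-distribˡ-+ (m % n) k n ⟩
    (m % n % n + k % n) % n  ≡⟨ cong (λ z → (z + k % n) % n) (m%n%n≡m%n m n) ⟩
    (m % n + k % n) % n      ≡⟨ %-distribˡ-+ m k n ⟨
    (m + k) % n              ∎
    where open ≡-Reasoning

  v+[n∸v%n]≡[1+v/n]*n : ∀ v → v + (n ∸ v % n) ≡ suc (v / n) * n
  v+[n∸v%n]≡[1+v/n]*n v = begin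
    v + (n ∸ v % n)                  ≡⟨ cong (_+ (n ∸ v % n)) (m≡m%n+[m/n]*n v n) ⟩
    v % n + v / n * n + (n ∸ v % n)  ≡⟨ cong (_+ (n ∸ v % n)) (+-comm (v % n) _) ⟩
    v / n * n + v % n + (n ∸ v % n)  ≡⟨ +-assoc (v / n * n) _ _ ⟩
    v / n * n + (v % n + (n ∸ v % n)) ≡⟨ cong (v / n * n +_) (m+[n∸m]≡n (m%n≤n v n)) ⟩
    v / n * n + n                    ≡⟨ +-comm (v / n * n) n ⟩
    suc (v / n) * n                  ∎
    where open ≡-Reasoning

  [x+[v+[n∸v%n]]]%n≡x%n : ∀ x v → (x + (v + (n ∸ v % n))) % n ≡ x % n
  [x+[v+[n∸v%n]]]%n≡x%n x v = trans (cong (λ z → (x + z) % n) (v+[n∸v%n]≡[1+v/n]*n v)) ([m+kn]%n≡m%n x (suc (v / n)) n)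

  toℕ-⊖ : ∀ v w → toℕ (ι n w ⊖ ι n v) ≡ (w % n + (n ∸ v % n)) % n
  toℕ-⊖ v w = trans (toℕ-ι _) (cong₂ (λ a b → (a + (n ∸ b)) % n) (toℕ-ι w) (toℕ-ι v))

  ⊖-ι : ∀ {d v w} → (v + d) % n ≡ w % n → ι n w ⊖ ι n v ≡ ι n d
  ⊖-ι {d} {v} {w} v+d≡w = Finₚ.toℕ-injective (begin
    toℕ (ι n w ⊖ ι n v)                ≡⟨ toℕ-⊖ v w ⟩
    (w % n + (n ∸ v % n)) % n          ≡⟨ cong (λ z → (z + (n ∸ v % n)) % n) v+d≡w ⟨
    ((v + d) % n + (n ∸ v % n)) % n    ≡⟨ [m%n+k]%n≡[m+k]%n (v + d) _ ⟩
    (v + d + (n ∸ v % n)) % n          ≡⟨ cong (_% n) (swap v d _) ⟩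
    (d + (v + (n ∸ v % n))) % n        ≡⟨ [x+[v+[n∸v%n]]]%n≡x%n d v ⟩
    d % n                              ≡⟨ toℕ-ι d ⟨
    toℕ (ι n d)                        ∎)
    where
    open ≡-Reasoning
    swap : ∀ a b c → a + b + c ≡ b + (a + c)
    swap = solve-∀

  [v+toℕ[w⊖v]]%n≡w%n : ∀ v w → (v + toℕ (ι n w ⊖ ι n v)) % n ≡ w % n
  [v+toℕ[w⊖v]]%n≡w%n v w = begin
    (v + toℕ (ι n w ⊖ ι n v)) % n            ≡⟨ cong (λ z → (v + z) % n) (toℕ-⊖ v w) ⟩
    (v + (w % n + (n ∸ v % n)) % n) % n      ≡⟨ cong (_% n) (+-comm v _) ⟩
    ((w % n + (n ∸ v % n)) % n + v) % n      ≡⟨ [m%n+k]%n≡[m+k]%n (w % n + (n ∸ v % n)) v ⟩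
    (w % n + (n ∸ v % n) + v) % n            ≡⟨ cong (_% n) (swap (w % n) (n ∸ v % n) v) ⟩
    (w % n + (v + (n ∸ v % n))) % n          ≡⟨ [x+[v+[n∸v%n]]]%n≡x%n (w % n) v ⟩
    w % n % n                                ≡⟨ m%n%n≡m%n w n ⟩
    w % n                                    ∎
    where
    open ≡-Reasoning
    swap : ∀ a b c → a + b + c ≡ a + (c + b)
    swap = solve-∀

  [v+d]%n≡w%n⇒[w+[n∸d]]%n≡v%n : ∀ {d v w} → d ≤ n → (v + d) % n ≡ w % n → (w + (n ∸ d)) % n ≡ v % n
  [v+d]%n≡w%n⇒[w+[n∸d]]%n≡v%n {d} {v} {w} d≤n v+d≡w = begin
    (w + (n ∸ d)) % n              ≡⟨ [m%n+k]%n≡[m+k]%n w (n ∸ d) ⟨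
    (w % n + (n ∸ d)) % n          ≡⟨ cong (λ z → (z + (n ∸ d)) % n) v+d≡w ⟨
    ((v + d) % n + (n ∸ d)) % n    ≡⟨ [m%n+k]%n≡[m+k]%n (v + d) (n ∸ d) ⟩
    (v + d + (n ∸ d)) % n          ≡⟨ cong (_% n) (+-assoc v d (n ∸ d)) ⟩
    (v + (d + (n ∸ d))) % n        ≡⟨ cong (λ z → (v + z) % n) (m+[n∸m]≡n d≤n) ⟩
    (v + n) % n                    ≡⟨ [m+n]%n≡m%n v n ⟩
    v % n                          ∎
    where open ≡-Reasoning

-- A record rather than a function, so that v and w are recovered by unification.
record Circ (n : ℕ) .{{_ : NonZero n}} (S : Subset n) (v w : ℕ) : Set where
  constructor circ
  field adj : Adj S (ι n v) (ι n w)

module _ {n : ℕ} .{{_ : NonZero n}} {S : Subset n} where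

  Circ-mod : ∀ {d v w} → ι n d ∈ S → (v + d) % n ≡ w % n → Circ n S v w
  Circ-mod d∈S v+d≡w = circ (subst (_∈ S) (sym (⊖-ι n v+d≡w)) d∈S)

  Circ-step : ∀ {d v w} → ι n d ∈ S → v + d ≡ w → Circ n S v w
  Circ-step d∈S refl = Circ-mod d∈S refl

  Circ-wrap : ∀ {d v w} → ι n d ∈ S → v + d ≡ w + n → Circ n S v w
  Circ-wrap {w = w} d∈S v+d≡w+n = Circ-mod d∈S (trans (cong (_% n) v+d≡w+n) ([m+n]%n≡m%n w n))

  Circ-suc : ι n 1 ∈ S → ∀ v → Circ n S v (suc v)
  Circ-suc 1∈S v = Circ-step 1∈S (+-comm v 1)

  -- With d = w ⊖ v ∈ S, the step n ∸ d, i.e. neg d ∈ S, leads from w back to v.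
  Circ-sym : (∀ x → x ∈ S → neg x ∈ S) → Symmetric (Circ n S)
  Circ-sym S-sym {v} {w} (circ v~w) =
    Circ-mod (S-sym _ v~w) ([v+d]%n≡w%n⇒[w+[n∸d]]%n≡v%n n (<⇒≤ (Finₚ.toℕ<n _)) ([v+toℕ[w⊖v]]%n≡w%n n v w))

  module _ (S-sym : ∀ x → x ∈ S → neg x ∈ S) {U : Fin n → Set} {R : ℕ → Set}
           (R? : Decidable R) (R⇒<n : ∀ {v} → R v → v < n) (R⇔¬U : ∀ x → R (toℕ x) ⇔ (¬ U x))
           (C : CycleCover (Circ n S) R) where
    open CycleCover C
    private
      R⇒¬U : ∀ {x} → R (toℕ x) → ¬ U x
      R⇒¬U = Equivalence.to (R⇔¬U _)

      weight : ℕ → ℕ → ℚ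
      weight x y with R? x | R? y
      ... | yes _ | yes _ = ½⟦ y ≟ σ x ⟧ +ℚ ½⟦ x ≟ σ y ⟧
      ... | _     | _     = 0ℚ

      weight-sym : ∀ x y → weight x y ≡ weight y x
      weight-sym x y with R? x | R? y
      ... | yes _ | yes _ = ℚ.+-comm ½⟦ y ≟ σ x ⟧ ½⟦ x ≟ σ y ⟧
      ... | yes _ | no _  = refl
      ... | no _  | yes _ = refl
      ... | no _  | no _  = refl

      weight-bounds : ∀ x y → 0ℚ ≤ℚ weight x y × weight x y ≤ℚ 1ℚ
      weight-bounds x y with R? x | R? y
      ... | yes _ | yes _ = ½⟦⟧+½⟦⟧-bounds (y ≟ σ x) (x ≟ σ y)
      ... | yes _ | no _  = 0≤0≤1
      ... | no _  | yes _ = 0≤0≤1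
      ... | no _  | no _  = 0≤0≤1

      adjacent : ∀ {i j : Fin n} → Circ n S (toℕ i) (toℕ j) → Adj S i j
      adjacent {i} {j} (circ i~j) = subst₂ (Adj S) (ι-toℕ n i) (ι-toℕ n j) i~j

      weight-support : ∀ i j → ¬ (Adj S i j × ¬ U i × ¬ U j) → weight (toℕ i) (toℕ j) ≡ 0ℚ
      weight-support i j non-edge with R? (toℕ i) | R? (toℕ j)
      ... | no _  | _     = refl
      ... | yes _ | no _  = refl
      ... | yes ri | yes rj with toℕ j ≟ σ (toℕ i) | toℕ i ≟ σ (toℕ j)
      ... | yes j≡σi | _        = ⊥-elim (non-edge (adjacent i~j , R⇒¬U ri , R⇒¬U rj))
        where i~j = subst (Circ n S _) (sym j≡σi) (edge ri)
      ... | no _     | yes i≡σj = ⊥-elim (non-edge (adjacent (Circ-sym S-sym j~i) , R⇒¬U ri , R⇒¬U rj))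
        where j~i = subst (Circ n S _) (sym i≡σj) (edge rj)
      ... | no _     | no _     = refl

      weight-row : ∀ {x} → R x → ∀ y → weight x y ≡ ½⟦ y ≟ σ x ⟧ +ℚ ½⟦ y ≟ τ x ⟧
      weight-row {x} rx y with R? x | R? y
      ... | no ¬rx | _ = ⊥-elim (¬rx rx)
      ... | yes _ | yes ry = cong (½⟦ y ≟ σ x ⟧ +ℚ_)
            (½⟦⟧-cong (λ x≡σy → trans (sym (τ∘σ ry)) (cong τ (sym x≡σy)))
                      (λ y≡τx → trans (sym (σ∘τ rx)) (cong σ (sym y≡τx))) (x ≟ σ y) (y ≟ τ x))
      ... | yes _ | no ¬ry with y ≟ σ x | y ≟ τ x
      ... | yes y≡σx | _ = ⊥-elim (¬ry (subst R (sym y≡σx) (σ-closed rx)))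
      ... | no _ | yes y≡τx = ⊥-elim (¬ry (subst R (sym y≡τx) (τ-closed rx)))
      ... | no _ | no _ = refl

      weight-perfect : ∀ x → ¬ U x → sumFin n (λ j → weight (toℕ x) (toℕ j)) ≡ 1ℚ
      weight-perfect x ¬Ux = begin
        sumFin n (λ j → weight (toℕ x) (toℕ j))                               ≡⟨ sumFin-cong n (weight-row rx ∘ toℕ) ⟩
        sumFin n (λ j → ½⟦ toℕ j ≟ σ (toℕ x) ⟧ +ℚ ½⟦ toℕ j ≟ τ (toℕ x) ⟧)     ≡⟨ sumFin-+ n _ _ ⟩
        sumFin n (λ j → ½⟦ toℕ j ≟ σ (toℕ x) ⟧) +ℚ sumFin n (λ j → ½⟦ toℕ j ≟ τ (toℕ x) ⟧)
          ≡⟨ cong₂ _+ℚ_ (sumFin-½⟦≟⟧ n (R⇒<n (σ-closed rx))) (sumFin-½⟦≟⟧ n (R⇒<n (τ-closed rx))) ⟩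
        ½ +ℚ ½                                                                ∎
        where
        open ≡-Reasoning
        rx : R (toℕ x)
        rx = Equivalence.from (R⇔¬U x) ¬Ux

    cycleCover⇒fpm : FracPerfectMatching n S U
    cycleCover⇒fpm = record
      { f       = λ i j → weight (toℕ i) (toℕ j)
      ; symm    = λ i j → weight-sym (toℕ i) (toℕ j)
      ; nonneg  = λ i j → proj₁ (weight-bounds (toℕ i) (toℕ j))
      ; le-one  = λ i j → proj₂ (weight-bounds (toℕ i) (toℕ j))
      ; support = weight-support
      ; perfect = weight-perfect
      }

-- Covering Γ − {0, s₁, a, a + 1} when a < s₁

Remaining : (n k α : ℕ) → ℕ → Set
Remaining n k α v = v < n × v ≢ 0 × v ≢ k × v ≢ α × v ≢ suc α

remaining? : ∀ n k α → Decidable (Remaining n k α)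
remaining? n k α v = (v <? n) ×-dec ¬? (v ≟ 0) ×-dec ¬? (v ≟ k) ×-dec ¬? (v ≟ α) ×-dec ¬? (v ≟ suc α)

remaining-below : ∀ {n k α v} → k < n → 0 < v → v < k → v ≢ α → v ≢ suc α → Remaining n k α v
remaining-below k<n 0<v v<k v≢α v≢1+α = <-trans v<k k<n , >⇒≢ 0<v , <⇒≢ v<k , v≢α , v≢1+α

remaining-above : ∀ {n k α v} → suc α < k → k < v → v < n → Remaining n k α v
remaining-above 1+α<k k<v v<n =
  v<n , >⇒≢ (≤-<-trans z≤n k<v) , >⇒≢ k<v , >⇒≢ (<-trans (<-trans (n<1+n _) 1+α<k) k<v) , >⇒≢ (<-trans 1+α<k k<v)

separated-cover : ∀ {n} .{{_ : NonZero n}} (S : Subset n) → (∀ x → x ∈ S → neg x ∈ S) → ∀ {k α} →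
                  ι n 1 ∈ S → ι n k ∈ S → 1 ≤ α → 3 + α ≤ k → suc (k + k) ≤ n →
                  CycleCover (Circ n S) (Remaining n k α)
separated-cover {suc m} S S-sym {suc j} {α} 1∈S k∈S 1≤α 3+α≤k (s≤s 2k≤m) =
  CycleCover-cong join split
    (⊎-cover (ladder? 1 j k α) disjoint
      (ladder-cover (Circ-sym S-sym) (≤-trans (n≤1+n j) (n≤1+n k)) 1≤α 2+α≤j
                    (λ v → Circ-step k∈S refl) (Circ-suc 1∈S _))
      (cycle-cover j+k≤m (inj₁ j<j+k) (Circ-step k∈S refl) (Circ-wrap {d = k} k∈S m+k≡j+n)
                   (Circ-suc 1∈S)))
  where
  k : ℕ
  k = suc j

  2+α≤j : 2 + α ≤ j
  2+α≤j = ≤-pred 3+α≤k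

  0<j : 0 < j
  0<j = ≤-trans (s≤s z≤n) 2+α≤j

  j<j+k : j < j + k
  j<j+k = m<m+n j {k} (s≤s z≤n)

  k<j+k : k < j + k
  k<j+k = m<n+m k 0<j

  j+k≤m : j + k ≤ m
  j+k≤m = ≤-trans (+-monoˡ-≤ k (n≤1+n j)) 2k≤m

  1+α<k : suc α < k
  1+α<k = m≤n⇒m≤1+n 2+α≤j

  k<n : k < suc m
  k<n = s≤s (≤-trans (m≤m+n k k) 2k≤m)

  m+k≡j+n : m + k ≡ j + suc m
  m+k≡j+n = trans (+-comm m k) (sym (+-suc j m))

  split : ∀ {v} → Remaining (suc m) k α v → Ladder 1 j k α v ⊎ Cycle j (j + k) m v
  split {v} (v<n , v≢0 , v≢k , v≢α , v≢1+α) with v <? j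
  ... | yes v<j = inj₁ (inj₁ ((n≢0⇒n>0 v≢0 , v<j) , v≢α , v≢1+α))
  ... | no v≮j with v ≟ j
  ...   | yes refl = inj₂ (inj₁ refl)
  ...   | no v≢j with v <? j + k
  ...     | yes v<j+k = inj₁ (inj₂ (k<v , v<j+k))
    where k<v = ≤∧≢⇒< (≤∧≢⇒< (≮⇒≥ v≮j) (v≢j ∘ sym)) (v≢k ∘ sym)
  ...     | no v≮j+k  = inj₂ (inj₂ (≮⇒≥ v≮j+k , ≤-pred v<n))

  join : ∀ {v} → Ladder 1 j k α v ⊎ Cycle j (j + k) m v → Remaining (suc m) k α v
  join (inj₁ (inj₁ ((0<v , v<j) , v≢α , v≢1+α))) = remaining-below k<n 0<v (<-trans v<j (n<1+n j)) v≢α v≢1+α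
  join (inj₁ (inj₂ (k<v , v<j+k)))               = remaining-above 1+α<k k<v (<-≤-trans v<j+k (m≤n⇒m≤1+n j+k≤m))
  join (inj₂ (inj₁ refl))                        = remaining-below k<n 0<j (n<1+n j) (>⇒≢ α<j) (>⇒≢ 2+α≤j)
    where α<j = ≤-trans (n≤1+n _) 2+α≤j
  join (inj₂ (inj₂ (j+k≤v , v≤m)))               = remaining-above 1+α<k (<-≤-trans k<j+k j+k≤v) (s≤s v≤m)

  disjoint : ∀ {v} → Cycle j (j + k) m v → ¬ Ladder 1 j k α v
  disjoint (inj₁ refl)          (inj₁ ((_ , j<j) , _)) = <-irrefl refl j<j
  disjoint (inj₁ refl)          (inj₂ (k<j , _))       = <-asym k<j (n<1+n j)
  disjoint (inj₂ (j+k≤v , _))   (inj₁ ((_ , v<j) , _)) = <⇒≱ v<j (≤-trans (m≤m+n j k) j+k≤v)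
  disjoint (inj₂ (j+k≤v , _))   (inj₂ (_ , v<j+k))     = <⇒≱ v<j+k j+k≤v

consecutive-cover : ∀ {n} .{{_ : NonZero n}} (S : Subset n) → (∀ x → x ∈ S → neg x ∈ S) → ∀ {α} →
                    ι n 1 ∈ S → ι n (2 + α) ∈ S → 2 ≤ α → suc ((2 + α) + (2 + α)) ≤ n →
                    CycleCover (Circ n S) (Remaining n (2 + α) α)
consecutive-cover {suc m} S S-sym {α} 1∈S k∈S 2≤α (s≤s 2k≤m) with m≤n⇒∃[o]m+o≡n 2k≤m
... | q , refl =
  CycleCover-cong join split
    (⊎-cover (ladder? 2 k d α) disjoint
      (ladder-cover (Circ-sym S-sym) (≤-trans (m≤m+n k q) (m≤n+m (k + q) 3)) 2≤α ≤-refl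
                    (λ v → Circ-sym S-sym (Circ-wrap {d = k} k∈S (v+d+k≡v+n v))) (Circ-suc 1∈S _))
      (cycle-cover (s≤s (≤-trans (m≤m+n k q) (n≤1+n _))) (inj₁ (s≤s (s≤s z≤n)))
                   (Circ-step k∈S refl) (Circ-wrap {d = k} k∈S 1+d+k≡1+n) (Circ-suc 1∈S)))
  where
  k d n : ℕ
  k = 2 + α
  d = suc (k + q)
  n = suc (k + k + q)

  v+d+k≡v+n : ∀ v → v + d + k ≡ v + n
  v+d+k≡v+n v = identity α q v
    where
    identity : ∀ α q v → v + suc (2 + α + q) + (2 + α) ≡ v + suc (2 + α + (2 + α) + q)
    identity = solve-∀
  1+d+k≡1+n : suc d + k ≡ 1 + n
  1+d+k≡1+n = v+d+k≡v+n 1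
  k+d≡n : k + d ≡ n
  k+d≡n = identity α q
    where
    identity : ∀ α q → (2 + α) + suc (2 + α + q) ≡ suc (2 + α + (2 + α) + q)
    identity = solve-∀

  1+α<k : suc α < k
  1+α<k = ≤-refl

  k<n : k < n
  k<n = s≤s (≤-trans (m≤m+n k k) (m≤m+n (k + k) q))

  k<2+d : k < 2 + d
  k<2+d = s≤s (≤-trans (m≤m+n k q) (m≤n+m (k + q) 2))

  1+d<n : suc d < n
  1+d<n = s≤s (+-monoˡ-≤ q (+-monoˡ-≤ k (s≤s (s≤s z≤n))))

  split : ∀ {v} → Remaining n k α v → Ladder 2 k d α v ⊎ Cycle 1 (suc k) (suc d) v
  split {v} (v<n , v≢0 , v≢k , v≢α , v≢1+α) with v ≟ 1
  ... | yes refl = inj₂ (inj₁ refl)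
  ... | no v≢1 with v <? α
  ...   | yes v<α = inj₁ (inj₁ ((2≤v , ≤-trans v<α (≤-trans (n≤1+n α) (n≤1+n (suc α)))) , v≢α , v≢1+α))
    where 2≤v = ≤∧≢⇒< (n≢0⇒n>0 v≢0) (v≢1 ∘ sym)
  ...   | no v≮α with v ≤? suc d
  ...     | yes v≤1+d = inj₂ (inj₂ (k<v , v≤1+d))
    where k<v = ≤∧≢⇒< (≤∧≢⇒< (≤∧≢⇒< (≮⇒≥ v≮α) (v≢α ∘ sym)) (v≢1+α ∘ sym)) (v≢k ∘ sym)
  ...     | no v≰1+d = inj₁ (inj₂ (≰⇒> v≰1+d , subst (v <_) (sym k+d≡n) v<n))

  join : ∀ {v} → Ladder 2 k d α v ⊎ Cycle 1 (suc k) (suc d) v → Remaining n k α v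
  join (inj₁ (inj₁ ((2≤v , v<k) , v≢α , v≢1+α))) = remaining-below k<n (<-trans (s≤s z≤n) 2≤v) v<k v≢α v≢1+α
  join {v} (inj₁ (inj₂ (2+d≤v , v<k+d)))         =
    remaining-above 1+α<k (<-≤-trans k<2+d 2+d≤v) (subst (v <_) k+d≡n v<k+d)
  join (inj₂ (inj₁ refl))                        =
    remaining-below k<n (s≤s z≤n) (s≤s (s≤s z≤n)) (<⇒≢ 2≤α) (<⇒≢ (≤-trans 2≤α (n≤1+n α)))
  join (inj₂ (inj₂ (k<v , v≤1+d)))               = remaining-above 1+α<k k<v (≤-<-trans v≤1+d 1+d<n)

  disjoint : ∀ {v} → Cycle 1 (suc k) (suc d) v → ¬ Ladder 2 k d α v
  disjoint (inj₁ refl)        (inj₁ ((2≤1 , _) , _)) = <-irrefl refl 2≤1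
  disjoint (inj₁ refl)        (inj₂ (2+d≤1 , _))     = <⇒≱ (s≤s (s≤s z≤n)) 2+d≤1
  disjoint (inj₂ (k<v , _))   (inj₁ ((_ , v<k) , _)) = <-asym k<v v<k
  disjoint (inj₂ (_ , v≤1+d)) (inj₂ (2+d≤v , _))     = <⇒≱ 2+d≤v v≤1+d

initial-cover : ∀ {n} .{{_ : NonZero n}} (S : Subset n) → (∀ x → x ∈ S → neg x ∈ S) → ∀ {t m} →
                ι n 1 ∈ S → ι n t ∈ S → 1 ≤ t → n ≡ 5 + t + 2 * m →
                CycleCover (Circ n S) (Remaining n 3 1)
initial-cover S S-sym {t} {m} 1∈S t∈S 1≤t refl =
  CycleCover-cong join split
    (⊎-cover (interval? (5 + t) n) disjoint
      (pairs-cover (Circ-sym S-sym) (Circ-suc 1∈S) (5 + t) m)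
      (cycle-cover (+-monoʳ-≤ 3 1≤t) (inj₂ (n<1+n (3 + t)))
                   (Circ-sym S-sym (Circ-step t∈S refl)) (Circ-suc 1∈S (3 + t)) (Circ-suc 1∈S)))
  where
  n : ℕ
  n = 5 + t + 2 * m

  4+t<n : 4 + t < n
  4+t<n = s≤s (m≤m+n (4 + t) (2 * m))

  split : ∀ {v} → Remaining n 3 1 v → (5 + t ≤ v < n) ⊎ Cycle (4 + t) 4 (3 + t) v
  split {0} (_ , v≢0 , _) = ⊥-elim (v≢0 refl)
  split {1} (_ , _ , _ , v≢1 , _) = ⊥-elim (v≢1 refl)
  split {2} (_ , _ , _ , _ , v≢2) = ⊥-elim (v≢2 refl)
  split {3} (_ , _ , v≢3 , _) = ⊥-elim (v≢3 refl)
  split {v@(suc (suc (suc (suc _))))} (v<n , _) with v ≤? 3 + t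
  ... | yes v≤3+t = inj₂ (inj₂ (s≤s (s≤s (s≤s (s≤s z≤n))) , v≤3+t))
  ... | no v≰3+t with v ≟ 4 + t
  ...   | yes refl = inj₂ (inj₁ refl)
  ...   | no v≢4+t = inj₁ (≤∧≢⇒< (≰⇒> v≰3+t) (v≢4+t ∘ sym) , v<n)

  join : ∀ {v} → (5 + t ≤ v < n) ⊎ Cycle (4 + t) 4 (3 + t) v → Remaining n 3 1 v
  join (inj₁ (5+t≤v , v<n))      = remaining-above ≤-refl (≤-trans (m≤m+n 4 (suc t)) 5+t≤v) v<n
  join (inj₂ (inj₁ refl))        = remaining-above ≤-refl (m≤m+n 4 t) 4+t<n
  join (inj₂ (inj₂ (4≤v , v≤3+t))) = remaining-above ≤-refl 4≤v (≤-<-trans v≤3+t (<-trans (n<1+n (3 + t)) 4+t<n))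

  disjoint : ∀ {v} → Cycle (4 + t) 4 (3 + t) v → ¬ (5 + t ≤ v < n)
  disjoint (inj₁ refl)         (5+t≤4+t , _) = <-irrefl refl 5+t≤4+t
  disjoint (inj₂ (_ , v≤3+t))  (5+t≤v , _)   = <⇒≱ (≤-trans (n≤1+n _) 5+t≤v) v≤3+t

module _ {n : ℕ} .{{_ : NonZero n}} {S : Subset n} (S-sym : ∀ x → x ∈ S → neg x ∈ S) where

  private
    toℕ≡⇒∈⁅ι⁆ : ∀ {x c} → toℕ x ≡ c → x ∈ ⁅ ι n c ⁆
    toℕ≡⇒∈⁅ι⁆ {x} refl = subst (_∈ ⁅ ι n (toℕ x) ⁆) (ι-toℕ n x) (x∈⁅x⁆ _)

    ±1,±3 : Subset n
    ±1,±3 = ⁅ ι n 1 ⁆ ∪ (⁅ ι n 3 ⁆ ∪ (⁅ ι n (n ∸ 3) ⁆ ∪ ⁅ ι n (n ∸ 1) ⁆))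

    ∣±1,±3∣<∣S∣ : 6 ≤ ∣ S ∣ → ∣ ±1,±3 ∣ < ∣ S ∣
    ∣±1,±3∣<∣S∣ 6≤∣S∣ =
      ≤-<-trans (∣⁅a,b,c,d⁆∣≤4 (ι n 1) (ι n 3) (ι n (n ∸ 3)) (ι n (n ∸ 1))) (≤-trans (n≤1+n 5) 6≤∣S∣)

  outside-±1,±3 : 6 ≤ ∣ S ∣ → ∃[ x ] x ∈ S × toℕ x ≢ 1 × toℕ x ≢ 3 × toℕ x ≢ n ∸ 3 × toℕ x ≢ n ∸ 1
  outside-±1,±3 6≤∣S∣ with ∣q∣<∣p∣⇒∃∈p∉q (∣±1,±3∣<∣S∣ 6≤∣S∣)
  ... | x , x∈S , x∉T =
    x , x∈S , x∉T ∘ x∈p∪q⁺ ∘ inj₁ ∘ toℕ≡⇒∈⁅ι⁆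
      , x∉T ∘ x∈p∪q⁺ ∘ inj₂ ∘ x∈p∪q⁺ ∘ inj₁ ∘ toℕ≡⇒∈⁅ι⁆
      , x∉T ∘ x∈p∪q⁺ ∘ inj₂ ∘ x∈p∪q⁺ ∘ inj₂ ∘ x∈p∪q⁺ ∘ inj₁ ∘ toℕ≡⇒∈⁅ι⁆
      , x∉T ∘ x∈p∪q⁺ ∘ inj₂ ∘ x∈p∪q⁺ ∘ inj₂ ∘ x∈p∪q⁺ ∘ inj₂ ∘ toℕ≡⇒∈⁅ι⁆

  odd-complement : ¬ 2 ∣ n → ι n 0 ∉ S → 6 ≤ ∣ S ∣ →
                   ∃[ o ] o < n × ¬ 2 ∣ o × o ≢ 1 × o ≢ 3 × ι n (n ∸ o) ∈ S
  odd-complement n-odd 0∉S 6≤∣S∣ with outside-±1,±3 6≤∣S∣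
  ... | x , x∈S , x≢1 , x≢3 , x≢n-3 , x≢n-1 with 2 ∣? toℕ x
  ...   | no x-odd   = toℕ x , Finₚ.toℕ<n x , x-odd , x≢1 , x≢3 , S-sym x x∈S
  ...   | yes x-even =
    n ∸ X , n∸X<n , n∸X-odd , x≢n-1 ∘ complement , x≢n-3 ∘ complement , subst (_∈ S) (sym ι[n∸[n∸X]]≡x) x∈S
    where
    X : ℕ
    X = toℕ x
    X≤n : X ≤ n
    X≤n = <⇒≤ (Finₚ.toℕ<n x)
    complement : ∀ {c} → n ∸ X ≡ c → X ≡ n ∸ c
    complement n∸X≡c = trans (sym (m∸[m∸n]≡n X≤n)) (cong (n ∸_) n∸X≡c)
    0<X : 0 < X
    0<X = n≢0⇒n>0 λ X≡0 → 0∉S (subst (_∈ S) (trans (sym (ι-toℕ n x)) (cong (ι n) X≡0)) x∈S)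
    n∸X<n : n ∸ X < n
    n∸X<n = ∸-monoʳ-< 0<X X≤n
    n∸X-odd : ¬ 2 ∣ n ∸ X
    n∸X-odd 2∣n∸X = n-odd (subst (2 ∣_) (m+[n∸m]≡n X≤n) (∣m∣n⇒∣m+n x-even 2∣n∸X))
    ι[n∸[n∸X]]≡x : ι n (n ∸ (n ∸ X)) ≡ x
    ι[n∸[n∸X]]≡x = trans (cong (ι n) (m∸[m∸n]≡n X≤n)) (ι-toℕ n x)

  even-step : ¬ 2 ∣ n → ι n 0 ∉ S → 6 ≤ ∣ S ∣ → ∃₂ λ t m → 1 ≤ t × ι n t ∈ S × n ≡ 5 + t + 2 * m
  even-step n-odd 0∉S 6≤∣S∣ with odd-complement n-odd 0∉S 6≤∣S∣
  ... | o , o<n , o-odd , o≢1 , o≢3 , n∸o∈S with odd≢1,3⇒≡5+2* o-odd o≢1 o≢3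
  ...   | m , refl =
    n ∸ o , m , m<n⇒0<n∸m o<n , n∸o∈S , trans (sym (m∸n+n≡m (<⇒≤ o<n))) (rearrange (n ∸ o) m)
    where
    rearrange : ∀ t m → t + (5 + 2 * m) ≡ 5 + t + 2 * m
    rearrange = solve-∀

module _ {n : ℕ} .{{_ : NonZero n}} (S : Subset n) (S-sym : ∀ x → x ∈ S → neg x ∈ S)
         (n-odd : ¬ 2 ∣ n) (0∉S : ι n 0 ∉ S) where

  private
    block-cover : ∀ {α} → ι n 1 ∈ S → ι n (2 + α) ∈ S → (2 + α ≡ 3 → 6 ≤ ∣ S ∣) → 1 ≤ α →
                  suc ((2 + α) + (2 + α)) ≤ n → CycleCover (Circ n S) (Remaining n (2 + α) α)
    block-cover {suc zero} 1∈S _ large _ _ with even-step S-sym n-odd 0∉S (large refl)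
    ... | t , m , 1≤t , t∈S , n≡5+t+2m = initial-cover S S-sym {m = m} 1∈S t∈S 1≤t n≡5+t+2m
    block-cover {suc (suc _)} 1∈S k∈S _ _ 2k<n = consecutive-cover S S-sym 1∈S k∈S (s≤s (s≤s z≤n)) 2k<n

  remaining-cover : ∀ {k α} → ι n 1 ∈ S → ι n k ∈ S → (k ≡ 3 → 6 ≤ ∣ S ∣) → 1 ≤ α → 2 + α ≤ k →
                    suc (k + k) ≤ n → CycleCover (Circ n S) (Remaining n k α)
  remaining-cover {k} {α} 1∈S k∈S large 1≤α 2+α≤k 2k<n with 3 + α ≤? k
  ... | yes 3+α≤k = separated-cover S S-sym 1∈S k∈S 1≤α 3+α≤k 2k<n
  ... | no 3+α≰k with ≤-antisym 2+α≤k (≤-pred (≰⇒> 3+α≰k))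
  ...   | refl = block-cover 1∈S k∈S large 1≤α 2k<n

remaining⇔not-removed : ∀ {n} .{{_ : NonZero n}} (s a : Fin n) → suc (toℕ a) < n → ∀ x →
  Remaining n (toℕ s) (toℕ a) (toℕ x) ⇔ (¬ (x ≡ ι n 0 ⊎ x ≡ s ⊎ x ≡ a ⊎ x ≡ a ⊕ ι n 1))
remaining⇔not-removed {n} s a 1+α<n x = mk⇔ to from
  where
  0<n : 0 < n
  0<n = ≤-<-trans z≤n 1+α<n

  toℕ[a⊕1] : toℕ (a ⊕ ι n 1) ≡ suc (toℕ a)
  toℕ[a⊕1] = begin
    toℕ (a ⊕ ι n 1)              ≡⟨ toℕ-ι n _ ⟩
    (toℕ a + toℕ (ι n 1)) % n    ≡⟨ cong (λ z → (toℕ a + z) % n) (toℕ-ι< n (≤-<-trans (s≤s z≤n) 1+α<n)) ⟩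
    (toℕ a + 1) % n              ≡⟨ cong (_% n) (+-comm (toℕ a) 1) ⟩
    suc (toℕ a) % n              ≡⟨ m<n⇒m%n≡m 1+α<n ⟩
    suc (toℕ a)                  ∎
    where open ≡-Reasoning

  to : Remaining n (toℕ s) (toℕ a) (toℕ x) → ¬ (x ≡ ι n 0 ⊎ x ≡ s ⊎ x ≡ a ⊎ x ≡ a ⊕ ι n 1)
  to (_ , x≢0 , _ , _ , _)   (inj₁ refl)                = x≢0 (toℕ-ι< n 0<n)
  to (_ , _ , x≢s , _ , _)   (inj₂ (inj₁ refl))         = x≢s refl
  to (_ , _ , _ , x≢a , _)   (inj₂ (inj₂ (inj₁ refl)))  = x≢a refl
  to (_ , _ , _ , _ , x≢1+a) (inj₂ (inj₂ (inj₂ refl)))  = x≢1+a toℕ[a⊕1]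

  from : ¬ (x ≡ ι n 0 ⊎ x ≡ s ⊎ x ≡ a ⊎ x ≡ a ⊕ ι n 1) → Remaining n (toℕ s) (toℕ a) (toℕ x)
  from unremoved = Finₚ.toℕ<n x
                 , (λ x≡0 → unremoved (inj₁ (Finₚ.toℕ-injective (trans x≡0 (sym (toℕ-ι< n 0<n))))))
                 , (λ x≡s → unremoved (inj₂ (inj₁ (Finₚ.toℕ-injective x≡s))))
                 , (λ x≡a → unremoved (inj₂ (inj₂ (inj₁ (Finₚ.toℕ-injective x≡a)))))
                 , (λ x≡1+a → unremoved (inj₂ (inj₂ (inj₂ (Finₚ.toℕ-injective (trans x≡1+a (sym toℕ[a⊕1])))))))

k≤[n∸1]/2⇒1+2k≤n : ∀ {n k} → 0 < n → k ≤ (n ∸ 1) / 2 → suc (k + k) ≤ n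
k≤[n∸1]/2⇒1+2k≤n {suc m} {k} _ k≤m/2 =
  s≤s (subst (_≤ m) (sym k+k≡k*2) (≤-trans (*-monoˡ-≤ 2 k≤m/2) (m/n*n≤m m 2)))
  where
  k+k≡k*2 : k + k ≡ k * 2
  k+k≡k*2 = trans (cong (k +_) (sym (+-identityʳ k))) (*-comm 2 k)

lemma3p11 : (n : ℕ) .{{_ : NonZero n}} → 5 ≤ n → ¬ (2 ∣ n) →
    (s₁ : Fin n) → 1 < toℕ s₁ → toℕ s₁ ≤ (n ∸ 1) / 2 →
    (S : Subset n) → ι n 0 ∉ S → (∀ x → x ∈ S → neg x ∈ S) →
    ι n 1 ∈ S → s₁ ∈ S →
    ((ι n 2 ∉ S × ι n 3 ∉ S) ⊎ 6 ≤ ∣ S ∣) →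
    (a : Fin n) → toℕ a ≢ n ∸ 1 → toℕ a ≢ 0 → toℕ a ≢ toℕ s₁ ∸ 1 → a ≢ s₁ →
    ¬ FracPerfectMatching n S
        (λ v → (v ≡ ι n 0) ⊎ (v ≡ s₁) ⊎ (v ≡ a) ⊎ (v ≡ (a ⊕ ι n 1))) →
    toℕ s₁ < toℕ a
lemma3p11 n 5≤n n-odd s₁ _ s₁≤[n∸1]/2 S 0∉S S-sym 1∈S s₁∈S small-or-large a _ a≢0 a≢s₁-1 a≢s₁ no-fpm
  with toℕ s₁ <? toℕ a
... | yes s₁<a = s₁<a
... | no s₁≮a =
  ⊥-elim (no-fpm (cycleCover⇒fpm S-sym (remaining? n k α) proj₁ (remaining⇔not-removed s₁ a 1+α<n) cover))
  where
  -- The hypotheses 1 < s₁ and a ≢ n − 1 are left unused: both follow from a + 2 ≤ s₁ < n / 2.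
  k α : ℕ
  k = toℕ s₁
  α = toℕ a

  2+α≤k : 2 + α ≤ k
  2+α≤k = ≤∧≢⇒< (≤∧≢⇒< (≮⇒≥ s₁≮a) (a≢s₁ ∘ Finₚ.toℕ-injective)) (a≢s₁-1 ∘ cong (_∸ 1))

  2k<n : suc (k + k) ≤ n
  2k<n = k≤[n∸1]/2⇒1+2k≤n (≤-trans (s≤s z≤n) 5≤n) s₁≤[n∸1]/2

  1+α<n : suc α < n
  1+α<n = ≤-trans 2+α≤k (≤-trans (m≤m+n k k) (≤-trans (n≤1+n _) 2k<n))

  k∈S : ι n k ∈ S
  k∈S = subst (_∈ S) (sym (ι-toℕ n s₁)) s₁∈S

  large : k ≡ 3 → 6 ≤ ∣ S ∣
  large k≡3 = [ (λ (_ , 3∉S) → ⊥-elim (3∉S (subst (_∈ S) (cong (ι n) k≡3) k∈S))) , id ] small-or-large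

  cover : CycleCover (Circ n S) (Remaining n k α)
  cover = remaining-cover S S-sym n-odd 0∉S 1∈S k∈S large (n≢0⇒n>0 a≢0) 2+α≤k 2k<n
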